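{- Let $m,n\ge1$, let $P$ be a partition of $[m]\times[n]$ that is not constructible, let $f$ be the most general tile assignment for $P$, and let $p_1,p_2\in P$, $p_1\neq p_2$, be parts with $f(p_1)_S=f(p_2)_S$ and $f(p_1)_W=f(p_2)_W$. Let $P[p_1,p_2]$ denote the partition obtained from $P$ by replacing $p_1,p_2$ with $p_1\cup p_2$. Then every constructible partition $C$ with $C\sqsubseteq P$ satisfies $C\sqsubseteq P[p_1,p_2]$.
   Context: For partitions $P,P'$ of $[m]\times[n]$: $P\sqsubseteq P'$ means every part of $P'$ is contained in some part of $P$ ($P'$ refines $P$). Directions: $N(x,y)=(x,y+1)$, $E(x,y)=(x+1,y)$, $S=N^{ -1}$, $W=E^{ -1}$, $\mathcal{D}=\{N,E,S,W\}$. A tile type is $t=(\sigma_N(t),\sigma_E(t),\sigma_S(t),\sigma_W(t))\in\Sigma^4$ over an infinite glue set $\Sigma$; for $g:P\to\Sigma^4$ write $g(p)_D=\sigma_D(g(p))$ and $[a]$ for the part containing position $a$. A most general tile assignment (MGTA) for $P$ is $f:P\to\Sigma^4$ such that (A1) $f([a])_E=f([E(a)])_W$ and $f([a])_N=f([N(a)])_S$ whenever both positions lie in $[m]\times[n]$; and (A2) for every $g:P\to\Sigma^4$ satisfying (A1) and all $(p_1,D_1),(p_2,D_2)\in P\times\mathcal{D}$, $f(p_1)_{D_1}=f(p_2)_{D_2}$ implies $g(p_1)_{D_1}=g(p_2)_{D_2}$; MGTAs exist and are unique up to relabeling of glues, and "the" MGTA is a fixed representative. Tile assembly model: a glue strength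 function $s$ is symmetric with $s(\sigma_1,\sigma_2)=0$ if $\sigma_1\ne\sigma_2$; an assembly is a partial map $\mathbb{Z}^2\to\Sigma^4$; a TAS $\mathscr{T}=(T,\mathcal{S},s,\tau)$ has finite tile set $T$, seed assembly $\mathcal{S}$, strength $s$, temperature $\tau$; $\mathcal{A}\to_{\mathscr{T}}\mathcal{A}'$ if $\mathcal{A}'=\mathcal{A}\cup\{((x,y),t)\}$ (disjoint), $t\in T$, and $\sum_D s(\sigma_D(t),\sigma_{D^{ -1}}(\mathcal{A}(D(x,y))))\ge\tau$ over $D$ with $\mathcal{A}(D(x,y))$ defined; produced = reachable from $\mathcal{S}$; terminal = produced and non-extendable. $\mathscr{T}$ is deterministic if for each produced assembly and position at most one tile of $T$ can extend it there. (P1): tiles of $T$ have bonding strength 1, $\tau=2$; (P2): the domain of $\mathcal{S}$ is $[0,m]\times\{0\}\cup\{0\}\times[0,n]$ and all terminal assemblies have domain $[0,m]\times[0,n]$. For deterministic $\mathscr{T}$ with P1, P2 and unique terminal assembly $\mathcal{A}$, $P(\mathscr{T})=\{\mathcal{A}^{ -1}(\{t\})\cap([m]\times[n]): t\in\mathcal{A}([m]\times[n])\}$. $P$ is constructible if $P=P(\mathscr{T})$ for some deterministic TAS $(T,\mathcal{S},s,2)$ with P1 and P2. -}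

module Defs where

open import Data.Nat as ℕ using (ℕ)
open import Data.Integer as ℤ using (ℤ; +_)
open import Data.Product using (Σ; ∃; ∃-syntax; _×_; _,_; proj₁; proj₂)
open import Data.Sum using (_⊎_; inj₁; inj₂)
open import Data.Maybe using (Maybe; just; nothing)
open import Data.List using (List)
open import Data.List.Membership.Propositional using (_∈_)
open import Relation.Nullary using (¬_)
open import Relation.Binary using (IsEquivalence)
open import Relation.Binary.PropositionalEquality
  using (_≡_; _≢_; refl; sym; trans)
open import Function.Bundles using (_⇔_)

Pos : Set
Pos = ℤ × ℤ

InGrid : ℕ → ℕ → Pos → Set
InGrid m n (x , y) = ((+ 1 ℤ.≤ x) × (x ℤ.≤ + m)) × ((+ 1 ℤ.≤ y) × (y ℤ.≤ + n))

GPos : ℕ → ℕ → Set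
GPos m n = Σ Pos (InGrid m n)

pos : ∀ {m n} → GPos m n → Pos
pos = proj₁

data Dir : Set where
  N E S W : Dir

move : Dir → Pos → Pos
move N (x , y) = (x , y ℤ.+ + 1)
move E (x , y) = (x ℤ.+ + 1 , y)
move S (x , y) = (x , y ℤ.- + 1)
move W (x , y) = (x ℤ.- + 1 , y)

opp : Dir → Dir
opp N = S
opp E = W
opp S = N
opp W = E

Glue : Set
Glue = ℕ

record Tile : Set where
  constructor tile
  field
    σN σE σS σW : Glue

open Tile public

σ : Dir → Tile → Glue
σ N t = σN t
σ E t = σE t
σ S t = σS t
σ W t = σW t

-- Partitions of [m]×[n], represented by their equivalence relation
-- "lie in the same part".

record Partition (m n : ℕ) : Set₁ where
  field
    _∼_   : GPos m n → GPos m n → Set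
    isEq  : IsEquivalence _∼_

open Partition public

_⊑_ : ∀ {m n} → Partition m n → Partition m n → Set
_⊑_ {m} {n} P P' = ∀ (a b : GPos m n) → _∼_ P' a b → _∼_ P a b

_≐_ : ∀ {m n} → Partition m n → Partition m n → Set
_≐_ {m} {n} P P' = ∀ (a b : GPos m n) → (_∼_ P a b ⇔ _∼_ P' a b)

-- P[p₁,p₂], where p₁ = [a₁], p₂ = [a₂]: replace p₁, p₂ by p₁ ∪ p₂
module _ {m n : ℕ} (P : Partition m n) (a₁ a₂ : GPos m n) where
  private
    _≈_ = _∼_ P
    module E = IsEquivalence (isEq P)

  InUnion : GPos m n → Set
  InUnion a = (a ≈ a₁) ⊎ (a ≈ a₂)

  mergedRel : GPos m n → GPos m n → Set
  mergedRel a b = (a ≈ b) ⊎ (InUnion a × InUnion b)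

  private
    union-resp : ∀ {a b} → a ≈ b → InUnion b → InUnion a
    union-resp ab (inj₁ x) = inj₁ (E.trans ab x)
    union-resp ab (inj₂ x) = inj₂ (E.trans ab x)

    m-refl : ∀ {a} → mergedRel a a
    m-refl = inj₁ E.refl

    m-sym : ∀ {a b} → mergedRel a b → mergedRel b a
    m-sym (inj₁ ab) = inj₁ (E.sym ab)
    m-sym (inj₂ (ua , ub)) = inj₂ (ub , ua)

    m-trans : ∀ {a b c} → mergedRel a b → mergedRel b c → mergedRel a c
    m-trans (inj₁ ab) (inj₁ bc) = inj₁ (E.trans ab bc)
    m-trans (inj₁ ab) (inj₂ (ub , uc)) = inj₂ (union-resp ab ub , uc)
    m-trans (inj₂ (ua , ub)) (inj₁ bc) = inj₂ (ua , union-resp (E.sym bc) ub)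
    m-trans (inj₂ (ua , _)) (inj₂ (_ , uc)) = inj₂ (ua , uc)

  merge : Partition m n
  merge = record
    { _∼_  = mergedRel
    ; isEq = record { refl = m-refl ; sym = m-sym ; trans = m-trans } }

-- Tile assignments P → Σ⁴, represented as maps on positions that are
-- constant on parts (f([a]) is written f a).

RespectsParts : ∀ {m n} → Partition m n → (GPos m n → Tile) → Set
RespectsParts {m} {n} P f = ∀ (a b : GPos m n) → _∼_ P a b → f a ≡ f b

SatisfiesA1 : ∀ {m n} → (GPos m n → Tile) → Set
SatisfiesA1 {m} {n} f =
  (∀ (a b : GPos m n) → pos b ≡ move E (pos a) → σE (f a) ≡ σW (f b)) ×
  (∀ (a b : GPos m n) → pos b ≡ move N (pos a) → σN (f a) ≡ σS (f b))

TileAssignment : ∀ {m n} → Partition m n → (GPos m n → Tile) → Set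
TileAssignment P f = RespectsParts P f × SatisfiesA1 f

IsMGTA : ∀ {m n} → Partition m n → (GPos m n → Tile) → Set
IsMGTA {m} {n} P f =
  TileAssignment P f ×
  (∀ (g : GPos m n → Tile) → TileAssignment P g →
     ∀ (a₁ a₂ : GPos m n) (D₁ D₂ : Dir) →
       σ D₁ (f a₁) ≡ σ D₂ (f a₂) → σ D₁ (g a₁) ≡ σ D₂ (g a₂))

Assembly : Set
Assembly = Pos → Maybe Tile

StrengthFn : Set
StrengthFn = Glue → Glue → ℕ

IsStrengthFn : StrengthFn → Set
IsStrengthFn s =
  (∀ g₁ g₂ → s g₁ g₂ ≡ s g₂ g₁) × (∀ g₁ g₂ → g₁ ≢ g₂ → s g₁ g₂ ≡ 0)

record TAS : Set where
  field
    tiles : List Tile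
    seed  : Assembly
    str   : StrengthFn
    temp  : ℕ

open TAS public

bondIn : StrengthFn → Assembly → Pos → Tile → Dir → ℕ
bondIn s A p t D with A (move D p)
... | nothing = 0
... | just u  = s (σ D t) (σ (opp D) u)

bondSum : StrengthFn → Assembly → Pos → Tile → ℕ
bondSum s A p t =
  bondIn s A p t N ℕ.+ bondIn s A p t E ℕ.+ bondIn s A p t S ℕ.+ bondIn s A p t W

CanAttach : TAS → Assembly → Pos → Tile → Set
CanAttach 𝒯 A p t =
  (A p ≡ nothing) × (t ∈ tiles 𝒯) × (temp 𝒯 ℕ.≤ bondSum (str 𝒯) A p t)

Step : TAS → Assembly → Assembly → Set
Step 𝒯 A A' = ∃[ p ] ∃[ t ]
  (CanAttach 𝒯 A p t × (A' p ≡ just t) × (∀ q → q ≢ p → A' q ≡ A q))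

data Produced (𝒯 : TAS) : Assembly → Set where
  seedP : ∀ {A} → (∀ q → A q ≡ seed 𝒯 q) → Produced 𝒯 A
  stepP : ∀ {A A'} → Produced 𝒯 A → Step 𝒯 A A' → Produced 𝒯 A'

Terminal : TAS → Assembly → Set
Terminal 𝒯 A = Produced 𝒯 A × (∀ p t → ¬ CanAttach 𝒯 A p t)

Deterministic : TAS → Set
Deterministic 𝒯 = ∀ A p t t' → Produced 𝒯 A →
  CanAttach 𝒯 A p t → CanAttach 𝒯 A p t' → t ≡ t'

Defined : Assembly → Pos → Set
Defined A p = A p ≢ nothing

P1 : TAS → Set
P1 𝒯 = (∀ t → t ∈ tiles 𝒯 → ∀ D → str 𝒯 (σ D t) (σ D t) ≡ 1) × (temp 𝒯 ≡ 2)

InSeedDom : ℕ → ℕ → Pos → Set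
InSeedDom m n (x , y) =
  (((+ 0 ℤ.≤ x) × (x ℤ.≤ + m)) × (y ≡ + 0)) ⊎
  ((x ≡ + 0) × ((+ 0 ℤ.≤ y) × (y ℤ.≤ + n)))

InBox : ℕ → ℕ → Pos → Set
InBox m n (x , y) = ((+ 0 ℤ.≤ x) × (x ℤ.≤ + m)) × ((+ 0 ℤ.≤ y) × (y ℤ.≤ + n))

P2 : ℕ → ℕ → TAS → Set
P2 m n 𝒯 =
  (∀ p → Defined (seed 𝒯) p ⇔ InSeedDom m n p) ×
  (∀ A → Terminal 𝒯 A → ∀ p → Defined A p ⇔ InBox m n p)

UniqueTerminal : TAS → Assembly → Set
UniqueTerminal 𝒯 A = Terminal 𝒯 A × (∀ A' → Terminal 𝒯 A' → ∀ q → A' q ≡ A q)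

-- P(𝒯) computed from the terminal assembly A: the parts are the
-- nonempty sets A⁻¹({t}) ∩ ([m]×[n])
assemblyPartition : ∀ m n → Assembly → Partition m n
assemblyPartition m n A = record
  { _∼_  = λ a b → A (pos a) ≡ A (pos b)
  ; isEq = record { refl = refl ; sym = sym ; trans = trans } }

Constructible : ∀ {m n} → Partition m n → Set
Constructible {m} {n} P = ∃[ 𝒯 ]
  (IsStrengthFn (str 𝒯) × Deterministic 𝒯 × P1 𝒯 × P2 m n 𝒯 ×
   ∃[ A ] (UniqueTerminal 𝒯 A × (P ≐ assemblyPartition m n A)))

-- Read the terminal assembly of a TAS constructing C as a tile assignment g.
-- Since C ⊑ P, g respects P, and the placement rules give (A1), so g is a tile
-- assignment for P; by (A2) the tiles g a₁ and g a₂ then share their S and W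
-- glues.  Under (P1) and (P2) the tile at a₁ was attached using exactly its S
-- and W neighbours (its N and E neighbours were still empty), so at that moment
-- g a₂ could have been attached there as well.  Determinism forces
-- g a₁ ≡ g a₂, i.e. a₁ and a₂ lie in one part of C, whence C ⊑ P[p₁,p₂].
module Submission where

open import Defs
open import Data.Nat using (ℕ; _≤_)
open import Relation.Nullary using (¬_)
open import Relation.Binary.PropositionalEquality using (_≡_)

import Data.Nat as ℕ
import Data.Nat.Properties as ℕ
import Data.Integer as ℤ
import Data.Integer.Properties as ℤ
open import Data.Integer using (+_)
open import Data.Product using (∃-syntax; _×_; _,_; proj₁; proj₂)
open import Data.Product.Properties using (≡-dec)
open import Data.Sum using (inj₁; inj₂)
open import Data.Maybe using (Maybe; just; nothing)
open import Data.Maybe.Properties using (just-injective)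
open import Data.Empty using (⊥-elim)
open import Data.List.Membership.Propositional using (_∈_)
open import Relation.Nullary using (yes; no)
open import Relation.Binary using (IsEquivalence; DecidableEquality)
open import Relation.Binary.PropositionalEquality
  using (_≢_; refl; sym; trans; cong; cong₂; subst; subst₂; module ≡-Reasoning)
open import Function.Bundles using (Equivalence; _⇔_)

Interior : Pos → Set
Interior (x , y) = (+ 1 ℤ.≤ x) × (+ 1 ℤ.≤ y)

_≟ₚ_ : DecidableEquality Pos
_≟ₚ_ = ≡-dec ℤ._≟_ ℤ._≟_

interior-N : ∀ {p} → Interior p → Interior (move N p)
interior-N (hx , hy) = hx , ℤ.≤-trans hy (ℤ.i≤i+j _ (+ 1))

interior-E : ∀ {p} → Interior p → Interior (move E p)
interior-E (hx , hy) = ℤ.≤-trans hx (ℤ.i≤i+j _ (+ 1)) , hy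

+1-1 : ∀ i → i ℤ.+ + 1 ℤ.- + 1 ≡ i
+1-1 i = begin
  i ℤ.+ + 1 ℤ.- + 1      ≡⟨ ℤ.+-assoc i (+ 1) (ℤ.- + 1) ⟩
  i ℤ.+ (+ 1 ℤ.- + 1)    ≡⟨ cong (λ j → i ℤ.+ j) (ℤ.+-inverseʳ (+ 1)) ⟩
  i ℤ.+ + 0              ≡⟨ ℤ.+-identityʳ i ⟩
  i                      ∎
  where open ≡-Reasoning

move-S∘N : ∀ p → move S (move N p) ≡ p
move-S∘N (x , y) = cong (x ,_) (+1-1 y)

move-W∘E : ∀ p → move W (move E p) ≡ p
move-W∘E (x , y) = cong (_, y) (+1-1 x)

interior-grid : ∀ {m n} (a : GPos m n) → Interior (pos a)
interior-grid (_ , (hx , _) , (hy , _)) = hx , hy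

box-grid : ∀ {m n} (a : GPos m n) → InBox m n (pos a)
box-grid (_ , (hx , hx′) , (hy , hy′)) =
  (ℤ.≤-trans (ℤ.+≤+ ℕ.z≤n) hx , hx′) , (ℤ.≤-trans (ℤ.+≤+ ℕ.z≤n) hy , hy′)

just≢nothing : ∀ {t : Tile} → just t ≢ nothing
just≢nothing ()

+1≰+0 : ¬ (+ 1 ℤ.≤ + 0)
+1≰+0 (ℤ.+≤+ ())

seedDomain-interior : ∀ {m n} {A : Assembly} →
  (∀ p → Defined A p ⇔ InSeedDom m n p) → ∀ q → Interior q → A q ≡ nothing
seedDomain-interior {A = A} dom q iq with A q in eq
... | nothing = refl
... | just _ with Equivalence.to (dom q) (λ Aq≡nothing → just≢nothing (trans (sym eq) Aq≡nothing))
seedDomain-interior dom _ (_ , hy) | just _ | inj₁ (_ , refl) = ⊥-elim (+1≰+0 hy)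
seedDomain-interior dom _ (hx , _) | just _ | inj₂ (refl , _) = ⊥-elim (+1≰+0 hx)

defined⇒just : ∀ {o : Maybe Tile} → o ≢ nothing → ∃[ t ] o ≡ just t
defined⇒just {just t} _  = t , refl
defined⇒just {nothing} d = ⊥-elim (d refl)

_⊆ₐ_ : Assembly → Assembly → Set
B ⊆ₐ B′ = ∀ r u → B r ≡ just u → B′ r ≡ just u

step-⊆ : ∀ {𝒯 B B′} → Step 𝒯 B B′ → B ⊆ₐ B′
step-⊆ (p , _ , (Bp≡nothing , _) , _ , rest) r u Br≡u with r ≟ₚ p
... | yes refl = ⊥-elim (just≢nothing (trans (sym Br≡u) Bp≡nothing))
... | no r≢p   = trans (rest r r≢p) Br≡u

attachment-history : ∀ {𝒯 A} → Produced 𝒯 A → ∀ q t →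
  seed 𝒯 q ≡ nothing → A q ≡ just t →
  ∃[ B ] (Produced 𝒯 B × CanAttach 𝒯 B q t)
attachment-history (seedP A≗seed) q t seed≡nothing Aq≡t =
  ⊥-elim (just≢nothing (trans (sym Aq≡t) (trans (A≗seed q) seed≡nothing)))
attachment-history (stepP {B} prB (p , _ , can , B′p≡t′ , _)) q t seed≡nothing Aq≡t
  with q ≟ₚ p
... | yes refl with trans (sym B′p≡t′) Aq≡t
...   | refl = B , prB , can
attachment-history (stepP prB (p , _ , _ , _ , rest)) q t seed≡nothing Aq≡t
  | no q≢p = attachment-history prB q t seed≡nothing (trans (sym (rest q q≢p)) Aq≡t)

BoundSouthWest : Assembly → Pos → Tile → Set
BoundSouthWest B q t =
  (∃[ u ] (B (move S q) ≡ just u × σS t ≡ σN u)) ×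
  (∃[ v ] (B (move W q) ≡ just v × σW t ≡ σE v))

boundSouthWest-⊆ : ∀ {B B′ q t} → B ⊆ₐ B′ → BoundSouthWest B q t → BoundSouthWest B′ q t
boundSouthWest-⊆ B⊆B′ ((u , eu , gu) , (v , ev , gv)) =
  (u , B⊆B′ _ u eu , gu) , (v , B⊆B′ _ v ev , gv)

bondIn-empty : ∀ s B p t D → B (move D p) ≡ nothing → bondIn s B p t D ≡ 0
bondIn-empty s B p t D _ with B (move D p)
bondIn-empty s B p t D _  | nothing = refl
bondIn-empty s B p t D () | just _

bondIn-glue : ∀ s B p {t t′} D → σ D t ≡ σ D t′ → bondIn s B p t D ≡ bondIn s B p t′ D
bondIn-glue s B p D e with B (move D p)
... | nothing = refl
... | just u  = cong (λ g → s g (σ (opp D) u)) e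

bondSum-southWest : ∀ s B p t → B (move N p) ≡ nothing → B (move E p) ≡ nothing →
  bondSum s B p t ≡ bondIn s B p t S ℕ.+ bondIn s B p t W
bondSum-southWest s B p t noN noE
  rewrite bondIn-empty s B p t N noN | bondIn-empty s B p t E noE = refl

bondSum-southWest-glue : ∀ s B p {t t′} →
  B (move N p) ≡ nothing → B (move E p) ≡ nothing →
  σS t ≡ σS t′ → σW t ≡ σW t′ → bondSum s B p t ≡ bondSum s B p t′
bondSum-southWest-glue s B p {t} {t′} noN noE eS eW = begin
  bondSum s B p t                                   ≡⟨ bondSum-southWest s B p t noN noE ⟩
  bondIn s B p t S ℕ.+ bondIn s B p t W             ≡⟨ cong₂ ℕ._+_ (bondIn-glue s B p S eS)
                                                                    (bondIn-glue s B p W eW) ⟩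
  bondIn s B p t′ S ℕ.+ bondIn s B p t′ W           ≡⟨ sym (bondSum-southWest s B p t′ noN noE) ⟩
  bondSum s B p t′                                  ∎
  where open ≡-Reasoning

both-positive : ∀ {a b} → a ≤ 1 → b ≤ 1 → 2 ≤ a ℕ.+ b → (1 ≤ a) × (1 ≤ b)
both-positive {0}       {_}       _   b≤1 2≤b = ⊥-elim (ℕ.<⇒≱ 2≤b b≤1)
both-positive {ℕ.suc a} {0}       a≤1 _   2≤a =
  ⊥-elim (ℕ.<⇒≱ (subst (2 ≤_) (ℕ.+-identityʳ (ℕ.suc a)) 2≤a) a≤1)
both-positive {ℕ.suc _} {ℕ.suc _} _   _   _   = ℕ.s≤s ℕ.z≤n , ℕ.s≤s ℕ.z≤n

module Growth (𝒯 : TAS) (isS : IsStrengthFn (str 𝒯)) (p1 : P1 𝒯)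
              (seed-interior : ∀ q → Interior q → seed 𝒯 q ≡ nothing) where

  private s = str 𝒯

  WellPlaced : Assembly → Set
  WellPlaced B = ∀ q → Interior q → ∀ t → B q ≡ just t →
    t ∈ tiles 𝒯 × BoundSouthWest B q t

  -- A tile at N p (resp. E p) is bound to its S (resp. W) neighbour p.
  north-empty : ∀ {B} → WellPlaced B → ∀ p → Interior p → B p ≡ nothing →
    B (move N p) ≡ nothing
  north-empty {B} wp p ip Bp≡nothing with B (move N p) in eq
  ... | nothing = refl
  ... | just u with wp (move N p) (interior-N ip) u eq
  ...   | _ , (_ , e , _) , _ =
    ⊥-elim (just≢nothing (trans (sym e) (trans (cong B (move-S∘N p)) Bp≡nothing)))

  east-empty : ∀ {B} → WellPlaced B → ∀ p → Interior p → B p ≡ nothing →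
    B (move E p) ≡ nothing
  east-empty {B} wp p ip Bp≡nothing with B (move E p) in eq
  ... | nothing = refl
  ... | just u with wp (move E p) (interior-E ip) u eq
  ...   | _ , _ , (_ , e , _) =
    ⊥-elim (just≢nothing (trans (sym e) (trans (cong B (move-W∘E p)) Bp≡nothing)))

  bondIn≤1 : ∀ B p t D → t ∈ tiles 𝒯 → bondIn s B p t D ≤ 1
  bondIn≤1 B p t D t∈T with B (move D p)
  ... | nothing = ℕ.z≤n
  ... | just u with σ D t ℕ.≟ σ (opp D) u
  ...   | yes e  rewrite sym e | proj₁ p1 t t∈T D = ℕ.≤-refl
  ...   | no e̸ rewrite proj₂ isS _ _ e̸ = ℕ.z≤n

  bondIn-positive : ∀ B p t D → 1 ≤ bondIn s B p t D →
    ∃[ u ] (B (move D p) ≡ just u × σ D t ≡ σ (opp D) u)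
  bondIn-positive B p t D pos with B (move D p)
  bondIn-positive B p t D () | nothing
  ... | just u with σ D t ℕ.≟ σ (opp D) u
  ...   | yes e  = u , refl , e
  ...   | no e̸ rewrite proj₂ isS _ _ e̸ = ⊥-elim (ℕ.<⇒≱ pos ℕ.z≤n)

  -- At temperature 2 with strength-1 glues both remaining neighbours must bind.
  attach-boundSouthWest : ∀ {B q t} → WellPlaced B → Interior q → CanAttach 𝒯 B q t →
    BoundSouthWest B q t
  attach-boundSouthWest {B} {q} {t} wp iq (Bq≡nothing , t∈T , τ≤sum) =
    let S-pos , W-pos = both-positive (bondIn≤1 B q t S t∈T) (bondIn≤1 B q t W t∈T) 2≤S+W
    in  bondIn-positive B q t S S-pos , bondIn-positive B q t W W-pos
    where
      2≤S+W : 2 ≤ bondIn s B q t S ℕ.+ bondIn s B q t W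
      2≤S+W = subst₂ _≤_ (proj₂ p1)
        (bondSum-southWest s B q t (north-empty wp q iq Bq≡nothing)
                                   (east-empty wp q iq Bq≡nothing)) τ≤sum

  wellPlaced : ∀ {B} → Produced 𝒯 B → WellPlaced B
  wellPlaced (seedP B≗seed) q iq t Bq≡t =
    ⊥-elim (just≢nothing (trans (sym Bq≡t) (trans (B≗seed q) (seed-interior q iq))))
  wellPlaced (stepP {B} {B′} prB st@(p , _ , can , B′p≡t′ , _)) q iq t B′q≡t with q ≟ₚ p
  ... | yes refl with trans (sym B′p≡t′) B′q≡t
  ...   | refl = proj₁ (proj₂ can) ,
                 boundSouthWest-⊆ {B} {B′} {q} {t} (step-⊆ {𝒯} st)
                   (attach-boundSouthWest (wellPlaced prB) iq can)
  wellPlaced (stepP {B} {B′} prB st@(_ , _ , _ , _ , rest)) q iq t B′q≡t | no q≢p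
    with wellPlaced prB q iq t (trans (sym (rest q q≢p)) B′q≡t)
  ... | t∈T , bound = t∈T , boundSouthWest-⊆ {B} {B′} {q} {t} (step-⊆ {𝒯} st) bound

  -- When t was attached at q only its S and W glues mattered, so t′ could
  -- have been attached instead.
  southWest-determines-tile : Deterministic 𝒯 → ∀ {A} → Produced 𝒯 A →
    ∀ q → Interior q → ∀ {t t′} → A q ≡ just t → t′ ∈ tiles 𝒯 →
    σS t ≡ σS t′ → σW t ≡ σW t′ → t ≡ t′
  southWest-determines-tile det prA q iq {t} {t′} Aq≡t t′∈T eS eW
    with attachment-history prA q t (seed-interior q iq) Aq≡t
  ... | B , prB , can@(Bq≡nothing , _ , τ≤sum) =
    det B q t t′ prB can (Bq≡nothing , t′∈T , subst (temp 𝒯 ≤_) same-sum τ≤sum)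
    where
      same-sum : bondSum s B q t ≡ bondSum s B q t′
      same-sum = bondSum-southWest-glue s B q
        (north-empty (wellPlaced prB) q iq Bq≡nothing)
        (east-empty (wellPlaced prB) q iq Bq≡nothing) eS eW

respectsParts-⊑ : ∀ {m n} {C P : Partition m n} {g : GPos m n → Tile} →
  C ⊑ P → RespectsParts C g → RespectsParts P g
respectsParts-⊑ C⊑P resp a b a∼b = resp a b (C⊑P a b a∼b)

⊑-merge : ∀ {m n} {C P : Partition m n} {a₁ a₂ : GPos m n} →
  C ⊑ P → _∼_ C a₁ a₂ → C ⊑ merge P a₁ a₂
⊑-merge {C = C} {P} {a₁} {a₂} C⊑P a₁∼a₂ = merged
  where
    module C = IsEquivalence (isEq C)
    to-a₁ : ∀ a → InUnion P a₁ a₂ a → _∼_ C a a₁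
    to-a₁ a (inj₁ a∼a₁) = C⊑P a a₁ a∼a₁
    to-a₁ a (inj₂ a∼a₂) = C.trans (C⊑P a a₂ a∼a₂) (C.sym a₁∼a₂)
    merged : C ⊑ merge P a₁ a₂
    merged a b (inj₁ a∼b)       = C⊑P a b a∼b
    merged a b (inj₂ (ua , ub)) = C.trans (to-a₁ a ua) (C.sym (to-a₁ b ub))

module Readout {m n : ℕ} (A : Assembly) (covers : ∀ (a : GPos m n) → Defined A (pos a)) where

  tileAt : GPos m n → Tile
  tileAt a = proj₁ (defined⇒just (covers a))

  tileAt-spec : ∀ a → A (pos a) ≡ just (tileAt a)
  tileAt-spec a = proj₂ (defined⇒just (covers a))

  tileAt-respects : RespectsParts (assemblyPartition m n A) tileAt
  tileAt-respects a b Aa≡Ab =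
    just-injective (trans (sym (tileAt-spec a)) (trans Aa≡Ab (tileAt-spec b)))

  tileAt-A1 : (∀ a → BoundSouthWest A (pos a) (tileAt a)) → SatisfiesA1 tileAt
  tileAt-A1 bound = east , north
    where
      east : ∀ a b → pos b ≡ move E (pos a) → σE (tileAt a) ≡ σW (tileAt b)
      east a b b≡Ea with proj₂ (bound b)
      ... | v , Ab-west≡v , gW = trans (cong σE v-is-a) (sym gW)
        where
          v-is-a : tileAt a ≡ v
          v-is-a = just-injective (begin
            just (tileAt a)           ≡⟨ sym (tileAt-spec a) ⟩
            A (pos a)                 ≡⟨ cong A (sym (move-W∘E (pos a))) ⟩
            A (move W (move E (pos a))) ≡⟨ cong (λ p → A (move W p)) (sym b≡Ea) ⟩
            A (move W (pos b))        ≡⟨ Ab-west≡v ⟩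
            just v                    ∎)
            where open ≡-Reasoning
      north : ∀ a b → pos b ≡ move N (pos a) → σN (tileAt a) ≡ σS (tileAt b)
      north a b b≡Na with proj₁ (bound b)
      ... | u , Ab-south≡u , gS = trans (cong σN u-is-a) (sym gS)
        where
          u-is-a : tileAt a ≡ u
          u-is-a = just-injective (begin
            just (tileAt a)           ≡⟨ sym (tileAt-spec a) ⟩
            A (pos a)                 ≡⟨ cong A (sym (move-S∘N (pos a))) ⟩
            A (move S (move N (pos a))) ≡⟨ cong (λ p → A (move S p)) (sym b≡Na) ⟩
            A (move S (pos b))        ≡⟨ Ab-south≡u ⟩
            just u                    ∎)
            where open ≡-Reasoning

lemma4 : (m n : ℕ) → 1 ≤ m → 1 ≤ n →
    (P : Partition m n) → ¬ Constructible P →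
    (f : GPos m n → Tile) → IsMGTA P f →
    (a₁ a₂ : GPos m n) → ¬ (_∼_ P a₁ a₂) →
    σS (f a₁) ≡ σS (f a₂) → σW (f a₁) ≡ σW (f a₂) →
    (C : Partition m n) → Constructible C → C ⊑ P →
    C ⊑ merge P a₁ a₂
lemma4 m n _ _ P _ f (_ , most-general) a₁ a₂ _ fS fW C
  (𝒯 , isS , det , p1 , (seedDom , terminalDom) , A , (terminal , _) , C≐A) C⊑P =
  ⊑-merge {C = C} {P} C⊑P (Equivalence.from (C≐A a₁ a₂) A-a₁≡A-a₂)
  where
    open Growth 𝒯 isS p1 (seedDomain-interior {m} {n} seedDom)
    open Readout A (λ a → Equivalence.from (terminalDom A terminal (pos a)) (box-grid a))
    placed : WellPlaced A
    placed = wellPlaced (proj₁ terminal)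
    g-assignment : TileAssignment P tileAt
    g-assignment =
      respectsParts-⊑ {C = C} {P} {tileAt} C⊑P
        (λ a b a∼b → tileAt-respects a b (Equivalence.to (C≐A a b) a∼b)) ,
      tileAt-A1 (λ a → proj₂ (placed (pos a) (interior-grid a) (tileAt a) (tileAt-spec a)))
    g₁≡g₂ : tileAt a₁ ≡ tileAt a₂
    g₁≡g₂ = southWest-determines-tile det (proj₁ terminal) (pos a₁) (interior-grid a₁)
      (tileAt-spec a₁)
      (proj₁ (placed (pos a₂) (interior-grid a₂) (tileAt a₂) (tileAt-spec a₂)))
      (most-general tileAt g-assignment a₁ a₂ S S fS)
      (most-general tileAt g-assignment a₁ a₂ W W fW)
    A-a₁≡A-a₂ : A (pos a₁) ≡ A (pos a₂)
    A-a₁≡A-a₂ = trans (tileAt-spec a₁) (trans (cong just g₁≡g₂) (sym (tileAt-spec a₂)))
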